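{- Let $G$ be a residue graph with respect to a positive integer $r$ and a finite graph $M=M(G)$ on vertex set $\{0,1,\dots,r-1\}$. Then $$\lim_{n\to\infty}\frac1n\log_2 T_G(n)\le C(M(G)).$$
   Context: Here $\mathbb{N}=\{1,2,3,\dots\}$ and $[n]=\{1,\dots,n\}$. For a graph $G$ on vertex set $\mathbb{N}$, two permutations $\pi,\sigma$ of $[n]$ are $G$-different if there is $i\in[n]$ such that $\{\pi(i),\sigma(i)\}$ is an edge of $G$; $T_G(n)$ is the maximum cardinality of a set of permutations of $[n]$ any two distinct members of which are $G$-different. $G$ is a residue graph with respect to $r$ and $M$ (a finite graph on $\{0,\dots,r-1\}$) if for all $a,b\in\mathbb{N}$: $\{a,b\}\in E(G)$ iff $\{a \bmod r, b\bmod r\}\in E(M)$. For a finite graph $M$ with vertex set $V$, sequences $\mathbf x,\mathbf y\in V^n$ are $M$-different if $\{x_i,y_i\}\in E(M)$ for some $i$; $\omega(M,n)$ is the largest cardinality of a set of pairwise $M$-different sequences in $V^n$, and the Shannon capacity (in this convention) is $C(M)=\limsup_{n\to\infty}\frac1n\log_2\omega(M,n)$. -}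

module Defs where

open import Data.Nat using (ℕ; zero; suc; _≤_; NonZero)
open import Data.Nat.DivMod using (_mod_)
open import Data.Fin using (Fin; toℕ)
open import Data.Fin.Permutation using (Permutation′; _⟨$⟩ʳ_)
open import Data.Product using (∃; ∃-syntax)
open import Relation.Nullary using (¬_)
open import Relation.Binary.PropositionalEquality using (_≡_)
open import Function.Bundles using (_⇔_)

record Graph (V : Set) : Set₁ where
  field
    Adj    : V → V → Set
    sym    : ∀ {x y} → Adj x y → Adj y x
    irrefl : ∀ {x} → ¬ Adj x x
open Graph public

IsResidueGraph : (r : ℕ) .{{_ : NonZero r}} → Graph (Fin r) → Graph ℕ → Set
IsResidueGraph r M G =
  ∀ (a b : ℕ) → 1 ≤ a → 1 ≤ b → (Adj G a b ⇔ Adj M (a mod r) (b mod r))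

-- Permutations of [n] = {1..n}, represented on Fin n (i ↦ toℕ i + 1).
GDifferent : Graph ℕ → {n : ℕ} → Permutation′ n → Permutation′ n → Set
GDifferent G {n} π σ =
  ∃[ i ] Adj G (suc (toℕ (π ⟨$⟩ʳ i))) (suc (toℕ (σ ⟨$⟩ʳ i)))

PairwiseGDifferent : Graph ℕ → {n t : ℕ} → (Fin t → Permutation′ n) → Set
PairwiseGDifferent G {n} {t} P = ∀ (i j : Fin t) → ¬ (i ≡ j) → GDifferent G (P i) (P j)

MDifferent : {V : Set} → Graph V → {m : ℕ} → (Fin m → V) → (Fin m → V) → Set
MDifferent M x y = ∃[ i ] Adj M (x i) (y i)

PairwiseMDifferent : {V : Set} → Graph V → {m w : ℕ} → (Fin w → Fin m → V) → Set
PairwiseMDifferent M {m} {w} X = ∀ (i j : Fin w) → ¬ (i ≡ j) → MDifferent M (X i) (X j)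

module Submission where

-- Reducing every entry of a permutation modulo r turns a
-- pairwise G-different family of t permutations of [n] into a pairwise
-- M-different family of t sequences in [r]^n, since a G-edge {π(i),σ(i)}
-- is by definition an M-edge between the residues; so T_G(n) ≤ ω(M,n).
-- Pairwise M-different families are closed under concatenation: pairing
-- a family of w₁ sequences of length m₁ with one of w₂ sequences of length
-- m₂ gives w₁w₂ pairwise M-different sequences of length m₁+m₂, because two
-- distinct pairs differ in some coordinate.  Iterating, the k-th power of
-- the reduced family has t^k members of length kn.  Taking k = K+1 and
-- m = kn, the required bound t^(qm) ≤ (t^k)^(qn) · 2^(pnm) holds with
-- equality before the factor 2^(pnm); hence N = 1 works for every ε.

open import Defs
open import Data.Nat using (ℕ; zero; suc; _+_; _*_; _^_; _≤_; NonZero; z≤n; s≤s)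
open import Data.Nat.DivMod using (_mod_)
open import Data.Nat.Properties
  using (m≤m*n; m^n≢0; ^-*-assoc; *-comm; *-assoc; n≤1+n; ≤-trans; ≤-reflexive)
open import Data.Fin using (Fin; toℕ; _↑ˡ_; _↑ʳ_; splitAt; remQuot; combine; _≟_)
import Data.Fin as Fin
open import Data.Fin.Properties using (splitAt-↑ˡ; splitAt-↑ʳ; combine-remQuot)
open import Data.Fin.Permutation using (Permutation′; _⟨$⟩ʳ_)
open import Data.Product using (_×_; ∃-syntax; _,_; proj₁; proj₂)
open import Data.Sum using (inj₁; inj₂)
open import Data.Empty using (⊥-elim)
open import Relation.Nullary using (yes; no)
open import Relation.Binary.PropositionalEquality
  using (_≡_; refl; cong; cong₂; subst₂; module ≡-Reasoning)
import Relation.Binary.PropositionalEquality as Eq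
open import Function.Bundles using (Equivalence)

residues : (r : ℕ) .{{_ : NonZero r}} → ∀ {n t} →
  (Fin t → Permutation′ n) → Fin t → Fin n → Fin r
residues r P i x = suc (toℕ (P i ⟨$⟩ʳ x)) mod r

module _ (r : ℕ) .{{_ : NonZero r}} (M : Graph (Fin r)) (G : Graph ℕ)
         (residue : IsResidueGraph r M G) where

  residues-different : ∀ {n t} (P : Fin t → Permutation′ n) →
    PairwiseGDifferent G P → PairwiseMDifferent M (residues r P)
  residues-different P different i j i≢j with different i j i≢j
  ... | x , edge = x , Equivalence.to (residue _ _ (s≤s z≤n) (s≤s z≤n)) edge

module _ {V : Set} (M : Graph V) where

  product : ∀ {w₁ w₂ m₁ m₂} → (Fin w₁ → Fin m₁ → V) → (Fin w₂ → Fin m₂ → V) →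
            Fin (w₁ * w₂) → Fin (m₁ + m₂) → V
  product {w₁} {w₂} {m₁} A B c x with splitAt m₁ x
  ... | inj₁ y = A (proj₁ (remQuot {w₁} w₂ c)) y
  ... | inj₂ y = B (proj₂ (remQuot {w₁} w₂ c)) y

  product-left : ∀ {w₁ w₂ m₁ m₂} (A : Fin w₁ → Fin m₁ → V) (B : Fin w₂ → Fin m₂ → V)
    c y → product A B c (y ↑ˡ m₂) ≡ A (proj₁ (remQuot {w₁} w₂ c)) y
  product-left {m₁ = m₁} {m₂} A B c y rewrite splitAt-↑ˡ m₁ y m₂ = refl

  product-right : ∀ {w₁ w₂ m₁ m₂} (A : Fin w₁ → Fin m₁ → V) (B : Fin w₂ → Fin m₂ → V)
    c y → product A B c (m₁ ↑ʳ y) ≡ B (proj₂ (remQuot {w₁} w₂ c)) y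
  product-right {m₁ = m₁} {m₂} A B c y rewrite splitAt-↑ʳ m₁ m₂ y = refl

  -- Distinct indices of the product differ in their A-part or in their
  -- B-part, and the corresponding factor supplies an M-edge.
  product-different : ∀ {w₁ w₂ m₁ m₂}
    (A : Fin w₁ → Fin m₁ → V) (B : Fin w₂ → Fin m₂ → V) →
    PairwiseMDifferent M A → PairwiseMDifferent M B →
    PairwiseMDifferent M (product A B)
  product-different {w₁} {w₂} {m₁} {m₂} A B dA dB c d c≢d
    with proj₁ (remQuot {w₁} w₂ c) ≟ proj₁ (remQuot {w₁} w₂ d)
       | proj₂ (remQuot {w₁} w₂ c) ≟ proj₂ (remQuot {w₁} w₂ d)
  ... | no a≢ | _ with dA _ _ a≢
  ...   | y , edge = y ↑ˡ m₂ ,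
          subst₂ (Adj M) (Eq.sym (product-left A B c y)) (Eq.sym (product-left A B d y)) edge
  product-different {w₁} {w₂} {m₁} {m₂} A B dA dB c d c≢d | yes _ | no b≢ with dB _ _ b≢
  ...   | y , edge = m₁ ↑ʳ y ,
          subst₂ (Adj M) (Eq.sym (product-right A B c y)) (Eq.sym (product-right A B d y)) edge
  product-different {w₁} {w₂} A B dA dB c d c≢d | yes a≡ | yes b≡ = ⊥-elim (c≢d c≡d)
    where
    open ≡-Reasoning
    c≡d : c ≡ d
    c≡d = begin
      c                                                             ≡⟨ Eq.sym (combine-remQuot {w₁} w₂ c) ⟩
      combine (proj₁ (remQuot {w₁} w₂ c)) (proj₂ (remQuot {w₁} w₂ c)) ≡⟨ cong₂ combine a≡ b≡ ⟩
      combine (proj₁ (remQuot {w₁} w₂ d)) (proj₂ (remQuot {w₁} w₂ d)) ≡⟨ combine-remQuot {w₁} w₂ d ⟩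
      d                                                             ∎

  power : ∀ {w m} → (Fin w → Fin m → V) → (k : ℕ) → Fin (w ^ k) → Fin (k * m) → V
  power A zero    _ ()
  power A (suc k) = product A (power A k)

  power-different : ∀ {w m} (A : Fin w → Fin m → V) → PairwiseMDifferent M A →
    (k : ℕ) → PairwiseMDifferent M (power A k)
  power-different A dA zero    Fin.zero Fin.zero c≢d = ⊥-elim (c≢d refl)
  power-different A dA (suc k) = product-different A (power A k) dA (power-different A dA k)

power-bound : ∀ t q k n e → t ^ (q * (k * n)) ≤ (t ^ k) ^ (q * n) * 2 ^ e
power-bound t q k n e = ≤-trans (≤-reflexive exponents) (m≤m*n _ _ {{m^n≢0 2 e}})
  where
  open ≡-Reasoning
  exponents : t ^ (q * (k * n)) ≡ (t ^ k) ^ (q * n)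
  exponents = begin
    t ^ (q * (k * n))  ≡⟨ cong (t ^_) (Eq.sym (*-assoc q k n)) ⟩
    t ^ (q * k * n)    ≡⟨ cong (λ e → t ^ (e * n)) (*-comm q k) ⟩
    t ^ (k * q * n)    ≡⟨ cong (t ^_) (*-assoc k q n) ⟩
    t ^ (k * (q * n))  ≡⟨ Eq.sym (^-*-assoc t k (q * n)) ⟩
    (t ^ k) ^ (q * n)  ∎

long-enough : ∀ K n → K ≤ suc K * suc n
long-enough K n = ≤-trans (n≤1+n K) (m≤m*n (suc K) (suc n))

positive-length : ∀ K n → 1 ≤ suc K * suc n
positive-length K n = ≤-trans (s≤s z≤n) (m≤m*n (suc K) (suc n))

corollary3 : ∀ (r : ℕ) .{{_ : NonZero r}} (M : Graph (Fin r)) (G : Graph ℕ) →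
    IsResidueGraph r M G →
    ∀ (p q : ℕ) → 1 ≤ p → 1 ≤ q →
    ∃[ N ] (∀ (n : ℕ) → N ≤ n →
      ∀ (t : ℕ) (P : Fin t → Permutation′ n) → PairwiseGDifferent G P →
      ∀ (K : ℕ) → ∃[ m ] (K ≤ m × 1 ≤ m ×
        ∃[ w ] ∃[ X ] (PairwiseMDifferent M {m} {w} X ×
          t ^ (q * m) ≤ w ^ (q * n) * 2 ^ (p * n * m))))
corollary3 r M G residue p q _ _ = 1 , bound
  where
  bound : ∀ (n : ℕ) → 1 ≤ n →
    ∀ (t : ℕ) (P : Fin t → Permutation′ n) → PairwiseGDifferent G P →
    ∀ (K : ℕ) → ∃[ m ] (K ≤ m × 1 ≤ m ×
      ∃[ w ] ∃[ X ] (PairwiseMDifferent M {m} {w} X ×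
        t ^ (q * m) ≤ w ^ (q * n) * 2 ^ (p * n * m)))
  bound (suc n) _ t P different K =
    suc K * suc n , long-enough K n , positive-length K n ,
    t ^ suc K , power M (residues r P) (suc K) ,
    power-different M (residues r P) (residues-different r M G residue P different) (suc K) ,
    power-bound t q (suc K) (suc n) (p * suc n * (suc K * suc n))
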